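{- Let $p$ be an odd prime and let $a,b$ be integers with $a,b,ab\not\equiv 0,1 \pmod p$. Then $$(1-ab)\,\gamma_p\!\left(\frac{1-b}{1-ab}\right)+(1-b)\,\gamma_p(a)\equiv (1-ab)\,\gamma_p\!\left(\frac{1-a}{1-ab}\right)+(1-a)\,\gamma_p(b) \pmod p,$$ where quotients are interpreted in $\mathbb{F}_p$.
   Context: For an odd prime $p$, the Mirimanoff polynomial is $\gamma_p(t):=\sum_{j=1}^{p-1} \frac{t^j}{j}$, regarded as a polynomial with coefficients in $\mathbb{F}_p$ (so $1/j$ is the inverse of $j$ modulo $p$), and evaluated at elements of $\mathbb{F}_p$. -}

module Defs where

open import Data.Nat using (ℕ; zero; suc; _+_; _*_; _∸_; _^_; _%_; NonZero)
open import Data.Nat.Properties using (_≟_)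
open import Data.List using (List; []; _∷_; map; upTo; filter; head)
open import Data.Nat.ListAction using (sum)
open import Data.Maybe using (Maybe; just; nothing)
open import Data.Integer using (ℤ)
open import Data.Integer.DivMod using (_%ℕ_)
open import Relation.Nullary using (does)
open import Relation.Nullary.Decidable using (⌊_⌋)

-- Residues modulo p are represented by natural numbers in [0, p).
-- Reduction of an integer modulo p (result in [0, p)).
red : ℤ → (p : ℕ) → .{{NonZero p}} → ℕ
red a p = a %ℕ p

-- Inverse of x modulo p: the least y in [0, p) with x * y ≡ 1 (mod p);
-- defaults to 0 if none exists (never happens for x ≢ 0 mod a prime p).
inv : (p : ℕ) → .{{NonZero p}} → ℕ → ℕ
inv p x with head (filter (λ y → ((x * y) % p) ≟ (1 % p)) (upTo p))
... | just y  = y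
... | nothing = 0

mirimanoff : (p : ℕ) → .{{NonZero p}} → ℕ → ℕ
mirimanoff p t = sum (map (λ j → (t ^ j) * inv p j) (map suc (upTo (p ∸ 1)))) % p

divp : (p : ℕ) → .{{NonZero p}} → ℕ → ℕ → ℕ
divp p x y = (x * inv p y) % p

{-# OPTIONS --safe #-}
module Submission where

-- Let Φ(x, y) = ((x + y)^p - x^p - y^p) / p, an integer polynomial. Since
-- 1/j ≡ (-1)^(j-1) C(p, j)/p (mod p), the Mirimanoff polynomial satisfies
-- γ_p(t) ≡ -Φ(-t, 1) = Φ(t, 1 - t) for odd p. Φ is homogeneous of degree p, so
-- by Fermat c Φ(x, y) ≡ Φ(c x, c y), and with c = 1 - ab invertible the left-hand
-- side becomes Φ(1 - b, b - ab) + Φ((1 - b) a, (1 - b)(1 - a)). With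
-- x = (1 - b) a, y = (1 - a) b, z = (1 - b)(1 - a) this is Φ(x + z, y) + Φ(x, z),
-- the right-hand side is Φ(y + z, x) + Φ(y, z), and both equal
-- ((x + y + z)^p - x^p - y^p - z^p) / p.

open import Algebra.Bundles using (Semiring)
import Algebra.Definitions.RawSemiring as RawSemiring
import Algebra.Properties.CommutativeSemiring.Binomial as Binomial
open import Data.Fin.Base using (toℕ)
open import Data.Integer using (ℤ; +_; _-_; _*_)
open import Data.Integer.Base as ℤ using (_+_; -_; _^_; 0ℤ; 1ℤ; -1ℤ)
open import Data.Integer.Divisibility.Signed
  using (_∣_; divides; ∣m∣n⇒∣m+n; ∣m⇒∣-m; ∣m⇒∣m*n; ∣n⇒∣m*n; ∣⇒∣ᵤ)
open import Data.Integer.DivMod using (_/ℕ_; a≡a%ℕn+[a/ℕn]*n; n%ℕd<d)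
import Data.Integer.Properties as ℤₚ
open import Algebra.Properties.CommutativeSemigroup ℤₚ.*-commutativeSemigroup using (x∙yz≈y∙xz)
open import Data.Integer.Tactic.RingSolver using (solve; solve-∀)
open import Data.List.Base using ([]; _∷_; map; filter; head; upTo; applyUpTo)
open import Data.List.Membership.Propositional.Properties using (∈-upTo⁺)
open import Data.List.Properties using (map-upTo; map-applyUpTo)
import Data.List.Relation.Unary.Any as Any
open import Data.List.Relation.Unary.Any using (Any; here; there)
open import Data.Maybe.Base using (just; nothing)
open import Data.Nat using (ℕ; NonZero) renaming (_+_ to _+ℕ_; _*_ to _*ℕ_; _%_ to _%ℕ_)
open import Data.Nat.Base as ℕ using (zero; suc; _<_; _≤_; _∸_)
open import Data.Nat.Combinatorics using (_C_; nCk+nC[k+1]≡[n+1]C[k+1]; nC1≡n; nCn≡1)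
open import Data.Nat.Coprimality using (prime⇒coprime; coprime-Bézout; coprime-divisor)
import Data.Nat.DivMod as ℕ
import Data.Nat.Divisibility as ℕᵈ
open import Data.Nat.GCD using (module Bézout)
open import Data.Nat.ListAction using (sum)
open import Data.Nat.Primality using (Prime; prime⇒irreducible; prime⇒nonTrivial; ¬prime[0])
import Data.Nat.Properties as ℕₚ
open import Data.Product.Base using (∃-syntax; _×_; _,_; proj₂; map₂)
open import Data.Sum.Base using ([_,_]′)
open import Defs
open import Function.Base using (_∘_)
open import Relation.Binary.Bundles using (Setoid)
open import Relation.Binary.PropositionalEquality
import Relation.Binary.Reasoning.Setoid as ≈-Reasoning
open import Relation.Nullary using (¬_; yes; no; contradiction)
open import Relation.Unary using (Pred; Decidable)

[k+1]*[n+1]C[k+1]≡[n+1]*nCk : ∀ n k → suc k ℕ.* (suc n C suc k) ≡ suc n ℕ.* (n C k)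
[k+1]*[n+1]C[k+1]≡[n+1]*nCk zero    zero    = refl
[k+1]*[n+1]C[k+1]≡[n+1]*nCk zero    (suc k) = ℕₚ.*-zeroʳ (suc (suc k))
[k+1]*[n+1]C[k+1]≡[n+1]*nCk (suc n) zero    =
  trans (ℕₚ.*-identityˡ _) (trans (nC1≡n (suc (suc n))) (sym (ℕₚ.*-identityʳ _)))
[k+1]*[n+1]C[k+1]≡[n+1]*nCk (suc n) (suc k) = begin
  suc (suc k) ℕ.* (suc (suc n) C suc (suc k))          ≡⟨ cong (suc (suc k) ℕ.*_) (sym (pascal (suc n) (suc k))) ⟩
  suc (suc k) ℕ.* (A ℕ.+ B)                            ≡⟨ ℕₚ.*-distribˡ-+ (suc (suc k)) A B ⟩
  A ℕ.+ suc k ℕ.* A ℕ.+ suc (suc k) ℕ.* B              ≡⟨ cong₂ (λ u v → A ℕ.+ u ℕ.+ v) (ih n k) (ih n (suc k)) ⟩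
  A ℕ.+ suc n ℕ.* (n C k) ℕ.+ suc n ℕ.* (n C suc k)    ≡⟨ ℕₚ.+-assoc A _ _ ⟩
  A ℕ.+ (suc n ℕ.* (n C k) ℕ.+ suc n ℕ.* (n C suc k))  ≡⟨ cong (A ℕ.+_) (ℕₚ.*-distribˡ-+ (suc n) (n C k) (n C suc k)) ⟨
  A ℕ.+ suc n ℕ.* (n C k ℕ.+ n C suc k)                ≡⟨ cong (λ z → A ℕ.+ suc n ℕ.* z) (pascal n k) ⟩
  suc (suc n) ℕ.* A                                     ∎
  where
  open ≡-Reasoning
  ih = [k+1]*[n+1]C[k+1]≡[n+1]*nCk
  pascal = nCk+nC[k+1]≡[n+1]C[k+1]
  A = suc n C suc k
  B = suc n C suc (suc k)

head-filter-satisfies : ∀ {a ℓ} {A : Set a} {P : Pred A ℓ} (P? : Decidable P) {xs} →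
                        Any P xs → ∃[ y ] head (filter P? xs) ≡ just y × P y
head-filter-satisfies P? {x ∷ _} any with P? x
... | yes px = x , refl , px
head-filter-satisfies P? (here px)  | no ¬px = contradiction px ¬px
head-filter-satisfies P? (there any) | no _  = head-filter-satisfies P? any

any-inverse⇒inv-inverse : ∀ p .{{_ : NonZero p}} x → Any (λ y → (x ℕ.* y) ℕ.% p ≡ 1 ℕ.% p) (upTo p) →
           (x ℕ.* inv p x) ℕ.% p ≡ 1 ℕ.% p
any-inverse⇒inv-inverse p x inverse-exists
  with head (filter (λ y → (x ℕ.* y) ℕ.% p ℕₚ.≟ 1 ℕ.% p) (upTo p))
     | head-filter-satisfies (λ y → (x ℕ.* y) ℕ.% p ℕₚ.≟ 1 ℕ.% p) inverse-exists
... | just y  | .y , refl , xy≡1 = xy≡1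
... | nothing | _  , ()   , _

∑< : ℕ → (ℕ → ℤ) → ℤ
∑< zero    f = 0ℤ
∑< (suc n) f = f 0 + ∑< n (f ∘ suc)

infix 5 ∑<
syntax ∑< n (λ k → e) = ∑[ k < n ] e

∑-cong : ∀ n {f g} → (∀ k → k < n → f k ≡ g k) → ∑< n f ≡ ∑< n g
∑-cong zero    _   = refl
∑-cong (suc n) f≡g = cong₂ _+_ (f≡g 0 (ℕ.s≤s ℕ.z≤n)) (∑-cong n (λ k k<n → f≡g (suc k) (ℕ.s≤s k<n)))

∑-last : ∀ n f → ∑< (suc n) f ≡ ∑< n f + f n
∑-last zero    f = ℤₚ.+-comm (f 0) 0ℤ
∑-last (suc n) f = trans (cong (_+_ (f 0)) (∑-last n (f ∘ suc))) (sym (ℤₚ.+-assoc (f 0) _ _))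

*-distribˡ-∑ : ∀ c n f → c * ∑< n f ≡ ∑[ k < n ] c * f k
*-distribˡ-∑ c zero    f = ℤₚ.*-zeroʳ c
*-distribˡ-∑ c (suc n) f = trans (ℤₚ.*-distribˡ-+ c (f 0) _) (cong (_+_ (c * f 0)) (*-distribˡ-∑ c n (f ∘ suc)))

-‿distrib-∑ : ∀ n f → - ∑< n f ≡ ∑[ k < n ] - f k
-‿distrib-∑ zero    f = refl
-‿distrib-∑ (suc n) f = trans (ℤₚ.neg-distrib-+ (f 0) _) (cong (_+_ (- f 0)) (-‿distrib-∑ n (f ∘ suc)))

+-sum-applyUpTo : ∀ (f : ℕ → ℕ) n → + sum (applyUpTo f n) ≡ ∑[ k < n ] + f k
+-sum-applyUpTo f zero    = refl
+-sum-applyUpTo f (suc n) = trans (ℤₚ.pos-+ (f 0) _) (cong (_+_ (+ f 0)) (+-sum-applyUpTo (f ∘ suc) n))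

binomial-theorem : ∀ n x y → (x + y) ^ n ≡ ∑[ k < suc n ] + (n C k) * (x ^ k * y ^ (n ∸ k))
binomial-theorem n x y = begin
  (x + y) ^ n                                                     ≡⟨ sym (^-agrees (x + y) n) ⟩
  (x + y) ℤ-Semiring.^ n                                          ≡⟨ Binomial.theorem ℤₚ.+-*-commutativeSemiring n x y ⟩
  ℤ-Semiring.sum {suc n} (generic-term ∘ toℕ)                     ≡⟨ sum-agrees (suc n) generic-term ⟩
  ∑[ k < suc n ] generic-term k                                    ≡⟨ ∑-cong (suc n) (λ k _ → term-agrees k) ⟩
  ∑[ k < suc n ] + (n C k) * (x ^ k * y ^ (n ∸ k))                ∎
  where
  open ≡-Reasoning
  module ℤ-Semiring = RawSemiring (Semiring.rawSemiring ℤₚ.+-*-semiring)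

  generic-term : ℕ → ℤ
  generic-term k = (n C k) ℤ-Semiring.× (x ℤ-Semiring.^ k * y ℤ-Semiring.^ (n ∸ k))

  ^-agrees : ∀ z j → z ℤ-Semiring.^ j ≡ z ^ j
  ^-agrees z zero    = refl
  ^-agrees z (suc j) = cong (z *_) (^-agrees z j)

  ×-agrees : ∀ j z → j ℤ-Semiring.× z ≡ + j * z
  ×-agrees zero    z = sym (ℤₚ.*-zeroˡ z)
  ×-agrees (suc j) z = trans (cong (_+_ z) (×-agrees j z)) (sym (ℤₚ.suc-* (+ j) z))

  sum-agrees : ∀ j (g : ℕ → ℤ) → ℤ-Semiring.sum {j} (g ∘ toℕ) ≡ ∑< j g
  sum-agrees zero    g = refl
  sum-agrees (suc j) g = cong (_+_ (g 0)) (sum-agrees j (g ∘ suc))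

  term-agrees : ∀ k → generic-term k ≡ + (n C k) * (x ^ k * y ^ (n ∸ k))
  term-agrees k = trans (×-agrees (n C k) _) (cong (+ (n C k) *_) (cong₂ _*_ (^-agrees x k) (^-agrees y (n ∸ k))))

prime⇒p∣pC[k+1] : ∀ {m k} → Prime (suc m) → k < m → suc m ℕᵈ.∣ suc m C suc k
prime⇒p∣pC[k+1] {m} {k} p-prime k<m = coprime-divisor (prime⇒coprime p-prime (ℕ.s≤s k<m))
  (ℕᵈ.divides (m C k) (trans ([k+1]*[n+1]C[k+1]≡[n+1]*nCk m k) (ℕₚ.*-comm (suc m) (m C k))))

prime≢2⇒odd : ∀ {p} → Prime p → p ≢ 2 → p ≡ suc (p ℕ./ 2 ℕ.* 2)
prime≢2⇒odd {p} p-prime p≢2 with p ℕ.% 2 | ℕ.m%n<n p 2 | ℕ.m≡m%n+[m/n]*n p 2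
... | 0           | _                     | p≡[p/2]*2 =
  [ (λ ()) , (λ 2≡p → contradiction (sym 2≡p) p≢2) ]′
    (prime⇒irreducible p-prime (ℕᵈ.divides (p ℕ./ 2) p≡[p/2]*2))
... | 1           | _                     | p≡1+[p/2]*2 = p≡1+[p/2]*2
... | suc (suc _) | ℕ.s≤s (ℕ.s≤s ())     | _

^-distrib-* : ∀ x y n → (x * y) ^ n ≡ x ^ n * y ^ n
^-distrib-* x y zero    = refl
^-distrib-* x y (suc n) = trans (cong (_*_ (x * y)) (^-distrib-* x y n)) (lemma x y (x ^ n) (y ^ n))
  where
  lemma : ∀ x y u v → x * y * (u * v) ≡ x * u * (y * v)
  lemma = solve-∀

pos-^ : ∀ a n → + (a ℕ.^ n) ≡ (+ a) ^ n
pos-^ a zero    = refl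
pos-^ a (suc n) = trans (ℤₚ.pos-* a (a ℕ.^ n)) (cong (_*_ (+ a)) (pos-^ a n))

[-x]^n≡[-1]^n*x^n : ∀ x n → (- x) ^ n ≡ -1ℤ ^ n * x ^ n
[-x]^n≡[-1]^n*x^n x n = trans (cong (_^ n) (sym (ℤₚ.-1*i≡-i x))) (^-distrib-* -1ℤ x n)

[-x]^odd≡-x^odd : ∀ x h → (- x) ^ suc (h ℕ.* 2) ≡ - x ^ suc (h ℕ.* 2)
[-x]^odd≡-x^odd x zero    = sym (ℤₚ.neg-distribˡ-* x 1ℤ)
[-x]^odd≡-x^odd x (suc h) = trans (cong (λ z → - x * (- x * z)) ([-x]^odd≡-x^odd x h)) (lemma x (x ^ suc (h ℕ.* 2)))
  where
  lemma : ∀ x y → - x * (- x * - y) ≡ - (x * (x * y))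
  lemma = solve-∀

module Congruence (n : ℤ) where

  infix 4 _≈_
  record _≈_ (x y : ℤ) : Set where
    constructor ≈-intro
    field n∣x-y : n ∣ x - y

  ≈-by : ∀ {x y} d → d ≡ x - y → n ∣ d → x ≈ y
  ≈-by d eq n∣d = ≈-intro (subst (n ∣_) eq n∣d)

  ≈-refl : ∀ {x} → x ≈ x
  ≈-refl {x} = ≈-intro (divides 0ℤ (ℤₚ.+-inverseʳ x))

  ≈-reflexive : ∀ {x y} → x ≡ y → x ≈ y
  ≈-reflexive refl = ≈-refl

  ≈-sym : ∀ {x y} → x ≈ y → y ≈ x
  ≈-sym {x} {y} (≈-intro n∣x-y) = ≈-by (- (x - y)) (solve (x ∷ y ∷ [])) (∣m⇒∣-m n∣x-y)

  ≈-trans : ∀ {x y z} → x ≈ y → y ≈ z → x ≈ z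
  ≈-trans {x} {y} {z} (≈-intro n∣x-y) (≈-intro n∣y-z) =
    ≈-by ((x - y) + (y - z)) (solve (x ∷ y ∷ z ∷ [])) (∣m∣n⇒∣m+n n∣x-y n∣y-z)

  ≈-setoid : Setoid _ _
  ≈-setoid = record
    { Carrier = ℤ ; _≈_ = _≈_
    ; isEquivalence = record { refl = ≈-refl ; sym = ≈-sym ; trans = ≈-trans } }

  +-cong : ∀ {x x′ y y′} → x ≈ x′ → y ≈ y′ → x + y ≈ x′ + y′
  +-cong {x} {x′} {y} {y′} (≈-intro n∣x-x′) (≈-intro n∣y-y′) =
    ≈-by ((x - x′) + (y - y′)) (solve (x ∷ x′ ∷ y ∷ y′ ∷ [])) (∣m∣n⇒∣m+n n∣x-x′ n∣y-y′)

  *-cong : ∀ {x x′ y y′} → x ≈ x′ → y ≈ y′ → x * y ≈ x′ * y′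
  *-cong {x} {x′} {y} {y′} (≈-intro n∣x-x′) (≈-intro n∣y-y′) =
    ≈-by ((x - x′) * y + x′ * (y - y′)) (solve (x ∷ x′ ∷ y ∷ y′ ∷ []))
      (∣m∣n⇒∣m+n (∣m⇒∣m*n y n∣x-x′) (∣n⇒∣m*n x′ n∣y-y′))

  -‿cong : ∀ {x y} → x ≈ y → - x ≈ - y
  -‿cong {x} {y} (≈-intro n∣x-y) = ≈-by (- (x - y)) (solve (x ∷ y ∷ [])) (∣m⇒∣-m n∣x-y)

  inverse-unique : ∀ {a x y} → a * x ≈ 1ℤ → a * y ≈ 1ℤ → x ≈ y
  inverse-unique {a} {x} {y} ax≈1 ay≈1 = begin
    x            ≡⟨ ℤₚ.*-identityʳ x ⟨
    x * 1ℤ       ≈⟨ *-cong (≈-refl {x}) (≈-sym ay≈1) ⟩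
    x * (a * y)  ≡⟨ solve (a ∷ x ∷ y ∷ []) ⟩
    a * x * y    ≈⟨ *-cong ax≈1 (≈-refl {y}) ⟩
    1ℤ * y       ≡⟨ ℤₚ.*-identityˡ y ⟩
    y            ∎
    where open ≈-Reasoning ≈-setoid

  ^-cong : ∀ {x y} k → x ≈ y → x ^ k ≈ y ^ k
  ^-cong zero    _   = ≈-refl
  ^-cong (suc k) x≈y = *-cong x≈y (^-cong k x≈y)

  ∑-cong-≈ : ∀ k {f g} → (∀ i → i < k → f i ≈ g i) → ∑< k f ≈ ∑< k g
  ∑-cong-≈ zero    _   = ≈-refl
  ∑-cong-≈ (suc k) f≈g = +-cong (f≈g 0 (ℕ.s≤s ℕ.z≤n)) (∑-cong-≈ k (λ i i<k → f≈g (suc i) (ℕ.s≤s i<k)))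

  n*x≈0 : ∀ x → n * x ≈ 0ℤ
  n*x≈0 x = ≈-by (x * n) (solve (n ∷ x ∷ [])) (divides x refl)

  x+k*n≈x : ∀ x k → x + k * n ≈ x
  x+k*n≈x x k = ≈-by (k * n) (solve (x ∷ k ∷ n ∷ [])) (divides k refl)

pos-1+* : ∀ a b → + (1 ℕ.+ a ℕ.* b) ≡ 1ℤ + + a * + b
pos-1+* a b = trans (ℤₚ.pos-+ 1 (a ℕ.* b)) (cong (_+_ 1ℤ) (ℤₚ.pos-* a b))

module Residues (p : ℕ) .{{_ : NonZero p}} where

  open Congruence (+ p) public

  red≈ : ∀ x → + red x p ≈ x
  red≈ x = ≈-trans (≈-sym (x+k*n≈x (+ red x p) (x /ℕ p))) (≈-reflexive (sym (a≡a%ℕn+[a/ℕn]*n x p)))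

  residue-unique : ∀ {r s} → r < p → s < p → + r ≈ + s → r ≡ s
  residue-unique {r} {s} r<p s<p (≈-intro p∣r-s) with ℤ.∣ + r - + s ∣ in eq
  ... | zero  = ℤₚ.+-injective (ℤₚ.i-j≡0⇒i≡j (+ r) (+ s) (ℤₚ.∣i∣≡0⇒i≡0 eq))
  ... | suc d = contradiction (ℕᵈ.∣⇒≤ (subst (p ℕᵈ.∣_) eq (∣⇒∣ᵤ p∣r-s))) (ℕₚ.<⇒≱ (begin-strict
    suc d                  ≡⟨ eq ⟨
    ℤ.∣ + r - + s ∣        ≡⟨ cong ℤ.∣_∣ (ℤₚ.m-n≡m⊖n r s) ⟩
    ℤ.∣ r ℤ.⊖ s ∣          ≤⟨ ℤₚ.∣m⊝n∣≤m⊔n r s ⟩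
    r ℕ.⊔ s                <⟨ ℕₚ.⊔-lub r<p s<p ⟩
    p                      ∎))
    where open ℕₚ.≤-Reasoning

  ≈⇒red≡ : ∀ {x y} → x ≈ y → red x p ≡ red y p
  ≈⇒red≡ {x} {y} x≈y =
    residue-unique (n%ℕd<d x p) (n%ℕd<d y p) (≈-trans (red≈ x) (≈-trans x≈y (≈-sym (red≈ y))))

  red≡⇒≈ : ∀ {x y} → red x p ≡ red y p → x ≈ y
  red≡⇒≈ {x} {y} eq = ≈-trans (≈-sym (red≈ x)) (≈-trans (≈-reflexive (cong +_ eq)) (red≈ y))

  inverse⇒inv-inverse : ∀ {n y} → + n * y ≈ 1ℤ → + n * + inv p n ≈ 1ℤ
  inverse⇒inv-inverse {n} {y} ny≈1 = begin
    + n * + inv p n    ≡⟨ ℤₚ.pos-* n (inv p n) ⟨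
    + (n ℕ.* inv p n)  ≈⟨ red≡⇒≈ (any-inverse⇒inv-inverse p n ỹ-inverse) ⟩
    1ℤ                 ∎
    where
    open ≈-Reasoning ≈-setoid
    nỹ≈1 : + (n ℕ.* red y p) ≈ 1ℤ
    nỹ≈1 = ≈-trans (≈-reflexive (ℤₚ.pos-* n (red y p))) (≈-trans (*-cong (≈-refl {+ n}) (red≈ y)) ny≈1)
    ỹ-inverse : Any (λ z → (n ℕ.* z) ℕ.% p ≡ 1 ℕ.% p) (upTo p)
    ỹ-inverse = Any.map (λ { refl → ≈⇒red≡ nỹ≈1 }) (∈-upTo⁺ (n%ℕd<d y p))

  module _ (p-prime : Prime p) where

    bézout⇒inverse : ∀ {r} → Bézout.Identity 1 p r → ∃[ y ] + r * y ≈ 1ℤ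
    bézout⇒inverse {r} (Bézout.-+ a b 1+ap≡br) = + b , (begin
      + r * + b          ≡⟨ sym (ℤₚ.pos-* r b) ⟩
      + (r ℕ.* b)        ≡⟨ cong +_ (trans (ℕₚ.*-comm r b) (sym 1+ap≡br)) ⟩
      + (1 ℕ.+ a ℕ.* p)  ≡⟨ pos-1+* a p ⟩
      1ℤ + + a * + p     ≈⟨ x+k*n≈x 1ℤ (+ a) ⟩
      1ℤ                 ∎)
      where open ≈-Reasoning ≈-setoid
    bézout⇒inverse {r} (Bézout.+- a b 1+br≡ap) = - + b , (begin
      + r * - + b            ≡⟨ r*-b≡1-[1+b*r] (+ r) (+ b) ⟩
      1ℤ - (1ℤ + + b * + r)  ≡⟨ cong (_-_ 1ℤ) (trans (sym (pos-1+* b r)) (cong +_ 1+br≡ap)) ⟩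
      1ℤ - + (a ℕ.* p)       ≡⟨ cong (_+_ 1ℤ) (trans (cong -_ (ℤₚ.pos-* a p)) (ℤₚ.neg-distribˡ-* (+ a) (+ p))) ⟩
      1ℤ + - + a * + p       ≈⟨ x+k*n≈x 1ℤ (- + a) ⟩
      1ℤ                     ∎)
      where
      open ≈-Reasoning ≈-setoid
      r*-b≡1-[1+b*r] : ∀ r b → r * - b ≡ 1ℤ - (1ℤ + b * r)
      r*-b≡1-[1+b*r] = solve-∀

    ∃-inverse : ∀ {x} → ¬ (x ≈ 0ℤ) → ∃[ y ] x * y ≈ 1ℤ
    ∃-inverse {x} x≉0 = map₂ (≈-trans (*-cong (≈-sym (red≈ x)) ≈-refl))
      (bézout⇒inverse (coprime-Bézout (prime⇒coprime p-prime {{ℕ.≢-nonZero r≢0}} (n%ℕd<d x p))))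
      where
      r≢0 : red x p ≢ 0
      r≢0 r≡0 = x≉0 (≈-trans (≈-sym (red≈ x)) (≈-reflexive (cong +_ r≡0)))

    *-inv≈1 : ∀ {n} → ¬ (+ n ≈ 0ℤ) → + n * + inv p n ≈ 1ℤ
    *-inv≈1 {n} n≉0 = inverse⇒inv-inverse {n} (proj₂ (∃-inverse n≉0))

module FermatQuotient (m : ℕ) (p-prime : Prime (suc m)) where

  p : ℕ
  p = suc m

  open Residues p public

  -- The division is exact for 0 < j < p, the only indices at which C/p is used.
  C/p : ℕ → ℤ
  C/p j = + ((p C j) ℕ./ p)

  p*C/p[k+1]≡pC[k+1] : ∀ {k} → k < m → + p * C/p (suc k) ≡ + (p C suc k)
  p*C/p[k+1]≡pC[k+1] k<m = trans (sym (ℤₚ.pos-* p _)) (cong +_ (ℕ.m*[n/m]≡n (prime⇒p∣pC[k+1] p-prime k<m)))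

  [k+1]*C/p[k+1]≡[p-1]Ck : ∀ {k} → k < m → + suc k * C/p (suc k) ≡ + (m C k)
  [k+1]*C/p[k+1]≡[p-1]Ck {k} k<m = ℤₚ.*-cancelˡ-≡ (+ p) _ _ (begin
    + p * (+ suc k * C/p (suc k))  ≡⟨ x∙yz≈y∙xz (+ p) (+ suc k) (C/p (suc k)) ⟩
    + suc k * (+ p * C/p (suc k))  ≡⟨ cong (_*_ (+ suc k)) (p*C/p[k+1]≡pC[k+1] k<m) ⟩
    + suc k * + (p C suc k)        ≡⟨ ℤₚ.pos-* (suc k) (p C suc k) ⟨
    + (suc k ℕ.* (p C suc k))      ≡⟨ cong +_ ([k+1]*[n+1]C[k+1]≡[n+1]*nCk m k) ⟩
    + (p ℕ.* (m C k))              ≡⟨ ℤₚ.pos-* p (m C k) ⟩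
    + p * + (m C k)                ∎)
    where open ≡-Reasoning

  [p-1]Ck≈[-1]^k : ∀ {k} → k ≤ m → + (m C k) ≈ -1ℤ ^ k
  [p-1]Ck≈[-1]^k {zero}  _   = ≈-refl
  [p-1]Ck≈[-1]^k {suc k} k<m = begin
    + (m C suc k)                              ≡⟨ b≡a+b-a (+ (m C k)) (+ (m C suc k)) ⟩
    (+ (m C k) + + (m C suc k)) - + (m C k)    ≡⟨ cong (_+ - + (m C k)) pascal ⟩
    + (p C suc k) - + (m C k)                  ≈⟨ +-cong pC[k+1]≈0 (-‿cong ([p-1]Ck≈[-1]^k (ℕₚ.<⇒≤ k<m))) ⟩
    0ℤ - -1ℤ ^ k                               ≡⟨ ℤₚ.+-identityˡ (- -1ℤ ^ k) ⟩
    - -1ℤ ^ k                                  ≡⟨ ℤₚ.-1*i≡-i (-1ℤ ^ k) ⟨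
    -1ℤ ^ suc k                                ∎
    where
    open ≈-Reasoning ≈-setoid
    b≡a+b-a : ∀ a b → b ≡ (a + b) - a
    b≡a+b-a = solve-∀
    pascal : + (m C k) + + (m C suc k) ≡ + (p C suc k)
    pascal = trans (sym (ℤₚ.pos-+ (m C k) (m C suc k))) (cong +_ (nCk+nC[k+1]≡[n+1]C[k+1] m k))
    pC[k+1]≈0 : + (p C suc k) ≈ 0ℤ
    pC[k+1]≈0 = ≈-trans (≈-reflexive (sym (p*C/p[k+1]≡pC[k+1] k<m))) (n*x≈0 (C/p (suc k)))

  red≢1⇒1-x≉0 : ∀ {x} → red x p ≢ 1 → ¬ (1ℤ - x ≈ 0ℤ)
  red≢1⇒1-x≉0 {x} red[x]≢1 1-x≈0 = red[x]≢1 (trans (≈⇒red≡ x≈1) (ℕ.m<n⇒m%n≡m 1<p))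
    where
    open ≈-Reasoning ≈-setoid
    1<p : 1 < p
    1<p = ℕ.nonTrivial⇒n>1 p {{prime⇒nonTrivial p-prime}}
    x≈1 : x ≈ 1ℤ
    x≈1 = begin
      x               ≡⟨ solve (x ∷ []) ⟩
      1ℤ - (1ℤ - x)   ≈⟨ +-cong (≈-refl {1ℤ}) (-‿cong 1-x≈0) ⟩
      1ℤ - 0ℤ         ≡⟨⟩
      1ℤ              ∎

  Φ : ℤ → ℤ → ℤ
  Φ x y = ∑[ k < m ] C/p (suc k) * (x ^ suc k * y ^ (m ∸ k))

  p*Φ≡[x+y]^p-x^p-y^p : ∀ x y → + p * Φ x y ≡ (x + y) ^ p - x ^ p - y ^ p
  p*Φ≡[x+y]^p-x^p-y^p x y = begin
    + p * Φ x y                                        ≡⟨ *-distribˡ-∑ (+ p) m _ ⟩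
    ∑[ k < m ] + p * (C/p (suc k) * monomial (suc k))  ≡⟨ ∑-cong m (λ k k<m → middle-term k<m) ⟩
    ∑< m (term ∘ suc)                                  ≡⟨ a≡[v+[a+u]]-u-v (∑< m (term ∘ suc)) (x ^ p) (y ^ p) ⟩
    y ^ p + (∑< m (term ∘ suc) + x ^ p) - x ^ p - y ^ p
      ≡⟨ cong (λ z → z - x ^ p - y ^ p) (cong₂ _+_ first-term (cong (_+_ (∑< m (term ∘ suc))) last-term)) ⟨
    term 0 + (∑< m (term ∘ suc) + term p) - x ^ p - y ^ p
      ≡⟨ cong (λ z → term 0 + z - x ^ p - y ^ p) (∑-last m (term ∘ suc)) ⟨
    ∑< (suc p) term - x ^ p - y ^ p                    ≡⟨ cong (λ z → z - x ^ p - y ^ p) (binomial-theorem p x y) ⟨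
    (x + y) ^ p - x ^ p - y ^ p                        ∎
    where
    open ≡-Reasoning
    monomial : ℕ → ℤ
    monomial k = x ^ k * y ^ (p ∸ k)
    term : ℕ → ℤ
    term k = + (p C k) * monomial k
    middle-term : ∀ {k} → k < m → + p * (C/p (suc k) * monomial (suc k)) ≡ term (suc k)
    middle-term {k} k<m = trans (sym (ℤₚ.*-assoc (+ p) (C/p (suc k)) (monomial (suc k))))
                                (cong (_* monomial (suc k)) (p*C/p[k+1]≡pC[k+1] k<m))
    first-term : term 0 ≡ y ^ p
    first-term = trans (ℤₚ.*-identityˡ _) (ℤₚ.*-identityˡ (y ^ p))
    last-term : term p ≡ x ^ p
    last-term = trans (cong₂ (λ c e → + c * (x ^ p * y ^ e)) (nCn≡1 p) (ℕₚ.n∸n≡0 p))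
                      (trans (ℤₚ.*-identityˡ _) (ℤₚ.*-identityʳ (x ^ p)))
    a≡[v+[a+u]]-u-v : ∀ a u v → a ≡ v + (a + u) - u - v
    a≡[v+[a+u]]-u-v = solve-∀

  [x+y]^p≈x^p+y^p : ∀ x y → (x + y) ^ p ≈ x ^ p + y ^ p
  [x+y]^p≈x^p+y^p x y = begin
    (x + y) ^ p                                       ≡⟨ s≡a+b+[s-a-b] ((x + y) ^ p) (x ^ p) (y ^ p) ⟩
    x ^ p + y ^ p + ((x + y) ^ p - x ^ p - y ^ p)     ≡⟨ cong (_+_ (x ^ p + y ^ p)) (p*Φ≡[x+y]^p-x^p-y^p x y) ⟨
    x ^ p + y ^ p + + p * Φ x y                       ≈⟨ +-cong (≈-refl {x ^ p + y ^ p}) (n*x≈0 (Φ x y)) ⟩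
    x ^ p + y ^ p + 0ℤ                                ≡⟨ ℤₚ.+-identityʳ (x ^ p + y ^ p) ⟩
    x ^ p + y ^ p                                     ∎
    where
    open ≈-Reasoning ≈-setoid
    s≡a+b+[s-a-b] : ∀ s a b → s ≡ a + b + (s - a - b)
    s≡a+b+[s-a-b] = solve-∀

  x^p≈x : ∀ x → x ^ p ≈ x
  x^p≈x x = begin
    x ^ p            ≈⟨ ^-cong p (≈-sym (red≈ x)) ⟩
    (+ red x p) ^ p  ≈⟨ n^p≈n (red x p) ⟩
    + red x p        ≈⟨ red≈ x ⟩
    x                ∎
    where
    open ≈-Reasoning ≈-setoid
    n^p≈n : ∀ n → (+ n) ^ p ≈ + n
    n^p≈n zero    = ≈-refl
    n^p≈n (suc n) = begin
      (1ℤ + + n) ^ p     ≈⟨ [x+y]^p≈x^p+y^p 1ℤ (+ n) ⟩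
      1ℤ ^ p + (+ n) ^ p ≈⟨ +-cong (≈-reflexive (ℤₚ.^-zeroˡ p)) (n^p≈n n) ⟩
      1ℤ + + n           ∎

  Φ-homogeneous : ∀ c x y → Φ (c * x) (c * y) ≡ c ^ p * Φ x y
  Φ-homogeneous c x y = ℤₚ.*-cancelˡ-≡ (+ p) _ _ (begin
    + p * Φ (c * x) (c * y)                              ≡⟨ p*Φ≡[x+y]^p-x^p-y^p (c * x) (c * y) ⟩
    (c * x + c * y) ^ p - (c * x) ^ p - (c * y) ^ p      ≡⟨ cong (λ z → z ^ p - (c * x) ^ p - (c * y) ^ p) (ℤₚ.*-distribˡ-+ c x y) ⟨
    (c * (x + y)) ^ p - (c * x) ^ p - (c * y) ^ p        ≡⟨ cong₂ (λ u v → u - v - (c * y) ^ p) (^-distrib-* c (x + y) p) (^-distrib-* c x p) ⟩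
    c ^ p * (x + y) ^ p - c ^ p * x ^ p - (c * y) ^ p    ≡⟨ cong (_-_ (c ^ p * (x + y) ^ p - c ^ p * x ^ p)) (^-distrib-* c y p) ⟩
    c ^ p * (x + y) ^ p - c ^ p * x ^ p - c ^ p * y ^ p  ≡⟨ factor (c ^ p) ((x + y) ^ p) (x ^ p) (y ^ p) ⟩
    c ^ p * ((x + y) ^ p - x ^ p - y ^ p)                ≡⟨ cong (_*_ (c ^ p)) (p*Φ≡[x+y]^p-x^p-y^p x y) ⟨
    c ^ p * (+ p * Φ x y)                                ≡⟨ x∙yz≈y∙xz (c ^ p) (+ p) (Φ x y) ⟩
    + p * (c ^ p * Φ x y)                                ∎)
    where
    open ≡-Reasoning
    factor : ∀ d s a b → d * s - d * a - d * b ≡ d * (s - a - b)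
    factor = solve-∀

  Φ-cong : ∀ {x x′ y y′} → x ≈ x′ → y ≈ y′ → Φ x y ≈ Φ x′ y′
  Φ-cong x≈x′ y≈y′ = ∑-cong-≈ m (λ k _ →
    *-cong (≈-refl {C/p (suc k)}) (*-cong (^-cong (suc k) x≈x′) (^-cong (m ∸ k) y≈y′)))

  *-Φ≈Φ-* : ∀ c x y → c * Φ x y ≈ Φ (c * x) (c * y)
  *-Φ≈Φ-* c x y = ≈-trans (*-cong (≈-sym (x^p≈x c)) (≈-refl {Φ x y})) (≈-reflexive (sym (Φ-homogeneous c x y)))

  Φ-cocycle : ∀ x y z → Φ (x + z) y + Φ x z ≡ Φ (y + z) x + Φ y z
  Φ-cocycle x y z = ℤₚ.*-cancelˡ-≡ (+ p) _ _ (begin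
    + p * (Φ (x + z) y + Φ x z)                  ≡⟨ ℤₚ.*-distribˡ-+ (+ p) (Φ (x + z) y) (Φ x z) ⟩
    + p * Φ (x + z) y + + p * Φ x z              ≡⟨ cong₂ _+_ (p*Φ≡[x+y]^p-x^p-y^p (x + z) y) (p*Φ≡[x+y]^p-x^p-y^p x z) ⟩
    δ (x + z) y + δ x z                          ≡⟨ cong (λ s → s ^ p - (x + z) ^ p - y ^ p + δ x z) (x+z+y≡y+z+x x y z) ⟩
    (y + z + x) ^ p - (x + z) ^ p - y ^ p + δ x z ≡⟨ regroup ((y + z + x) ^ p) ((x + z) ^ p) ((y + z) ^ p) (x ^ p) (y ^ p) (z ^ p) ⟩
    δ (y + z) x + δ y z                          ≡⟨ cong₂ _+_ (p*Φ≡[x+y]^p-x^p-y^p (y + z) x) (p*Φ≡[x+y]^p-x^p-y^p y z) ⟨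
    + p * Φ (y + z) x + + p * Φ y z              ≡⟨ ℤₚ.*-distribˡ-+ (+ p) (Φ (y + z) x) (Φ y z) ⟨
    + p * (Φ (y + z) x + Φ y z)                  ∎)
    where
    open ≡-Reasoning
    δ : ℤ → ℤ → ℤ
    δ u v = (u + v) ^ p - u ^ p - v ^ p
    x+z+y≡y+z+x : ∀ x y z → x + z + y ≡ y + z + x
    x+z+y≡y+z+x = solve-∀
    regroup : ∀ s a b u v w → s - a - v + (a - u - w) ≡ s - b - u + (b - v - w)
    regroup = solve-∀

  inv[k+1]≈[-1]^k*C/p[k+1] : ∀ {k} → k < m → + inv p (suc k) ≈ -1ℤ ^ k * C/p (suc k)
  inv[k+1]≈[-1]^k*C/p[k+1] {k} k<m = inverse-unique {+ suc k} (*-inv≈1 p-prime k+1≉0) (begin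
    + suc k * (-1ℤ ^ k * C/p (suc k))  ≡⟨ x∙yz≈y∙xz (+ suc k) (-1ℤ ^ k) (C/p (suc k)) ⟩
    -1ℤ ^ k * (+ suc k * C/p (suc k))  ≡⟨ cong (_*_ (-1ℤ ^ k)) ([k+1]*C/p[k+1]≡[p-1]Ck k<m) ⟩
    -1ℤ ^ k * + (m C k)                ≈⟨ *-cong (≈-refl { -1ℤ ^ k}) ([p-1]Ck≈[-1]^k (ℕₚ.<⇒≤ k<m)) ⟩
    -1ℤ ^ k * -1ℤ ^ k                  ≡⟨ ^-distrib-* -1ℤ -1ℤ k ⟨
    1ℤ ^ k                             ≡⟨ ℤₚ.^-zeroˡ k ⟩
    1ℤ                                 ∎)
    where
    open ≈-Reasoning ≈-setoid
    k+1≉0 : ¬ (+ suc k ≈ 0ℤ)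
    k+1≉0 k+1≈0 = ℕₚ.1+n≢0 (residue-unique (ℕ.s≤s k<m) ℕ.z<s k+1≈0)

  mirimanoff≈-Φ[-t,1] : ∀ t → + mirimanoff p t ≈ - Φ (- + t) 1ℤ
  mirimanoff≈-Φ[-t,1] t = begin
    + mirimanoff p t                              ≈⟨ red≈ (+ sum (map term (map suc (upTo m)))) ⟩
    + sum (map term (map suc (upTo m)))           ≡⟨ cong (+_ ∘ sum) (trans (cong (map term) (map-upTo suc m)) (map-applyUpTo suc term m)) ⟩
    + sum (applyUpTo (term ∘ suc) m)              ≡⟨ +-sum-applyUpTo (term ∘ suc) m ⟩
    ∑[ k < m ] + term (suc k)                     ≈⟨ ∑-cong-≈ m (λ k k<m → term≈ k<m) ⟩
    ∑[ k < m ] - (C/p (suc k) * ((- + t) ^ suc k * 1ℤ ^ (m ∸ k)))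
                                                  ≡⟨ -‿distrib-∑ m (λ k → C/p (suc k) * ((- + t) ^ suc k * 1ℤ ^ (m ∸ k))) ⟨
    - Φ (- + t) 1ℤ                                ∎
    where
    open ≈-Reasoning ≈-setoid
    term : ℕ → ℕ
    term j = t ℕ.^ j ℕ.* inv p j
    rearrange : ∀ u s c → u * (s * c) ≡ - (c * ((-1ℤ * s * u) * 1ℤ))
    rearrange = solve-∀
    term≈ : ∀ {k} → k < m → + term (suc k) ≈ - (C/p (suc k) * ((- + t) ^ suc k * 1ℤ ^ (m ∸ k)))
    term≈ {k} k<m = begin
      + term (suc k)                                         ≡⟨ ℤₚ.pos-* (t ℕ.^ suc k) (inv p (suc k)) ⟩
      + (t ℕ.^ suc k) * + inv p (suc k)                      ≡⟨ cong (_* + inv p (suc k)) (pos-^ t (suc k)) ⟩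
      (+ t) ^ suc k * + inv p (suc k)                        ≈⟨ *-cong (≈-refl {(+ t) ^ suc k}) (inv[k+1]≈[-1]^k*C/p[k+1] k<m) ⟩
      (+ t) ^ suc k * (-1ℤ ^ k * C/p (suc k))                ≡⟨ rearrange ((+ t) ^ suc k) (-1ℤ ^ k) (C/p (suc k)) ⟩
      - (C/p (suc k) * ((-1ℤ * -1ℤ ^ k * (+ t) ^ suc k) * 1ℤ))
        ≡⟨ cong₂ (λ u v → - (C/p (suc k) * (u * v))) ([-x]^n≡[-1]^n*x^n (+ t) (suc k)) (ℤₚ.^-zeroˡ (m ∸ k)) ⟨
      - (C/p (suc k) * ((- + t) ^ suc k * 1ℤ ^ (m ∸ k)))     ∎

  Φ-four-term : ∀ a b → let c = 1ℤ - a * b in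
    Φ (1ℤ - b) (c - (1ℤ - b)) + Φ ((1ℤ - b) * a) ((1ℤ - b) * (1ℤ - a))
      ≡ Φ (1ℤ - a) (c - (1ℤ - a)) + Φ ((1ℤ - a) * b) ((1ℤ - a) * (1ℤ - b))
  Φ-four-term a b = begin
    Φ (1ℤ - b) (c - (1ℤ - b)) + Φ x z  ≡⟨ cong (_+ Φ x z) (cong₂ Φ 1-b≡x+z c-[1-b]≡y) ⟩
    Φ (x + z) y + Φ x z                ≡⟨ Φ-cocycle x y z ⟩
    Φ (y + z) x + Φ y z                ≡⟨ cong₂ _+_ (cong₂ Φ 1-a≡y+z c-[1-a]≡x) (cong (Φ y) (ℤₚ.*-comm (1ℤ - a) (1ℤ - b))) ⟨
    Φ (1ℤ - a) (c - (1ℤ - a)) + Φ y ((1ℤ - a) * (1ℤ - b))  ∎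
    where
    open ≡-Reasoning
    c x y z : ℤ
    c = 1ℤ - a * b
    x = (1ℤ - b) * a
    y = (1ℤ - a) * b
    z = (1ℤ - b) * (1ℤ - a)
    1-b≡x+z : 1ℤ - b ≡ (1ℤ - b) * a + (1ℤ - b) * (1ℤ - a)
    1-b≡x+z = solve (a ∷ b ∷ [])
    1-a≡y+z : 1ℤ - a ≡ (1ℤ - a) * b + (1ℤ - b) * (1ℤ - a)
    1-a≡y+z = solve (a ∷ b ∷ [])
    c-[1-b]≡y : 1ℤ - a * b - (1ℤ - b) ≡ (1ℤ - a) * b
    c-[1-b]≡y = solve (a ∷ b ∷ [])
    c-[1-a]≡x : 1ℤ - a * b - (1ℤ - a) ≡ (1ℤ - b) * a
    c-[1-a]≡x = solve (a ∷ b ∷ [])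

  module _ (p≢2 : p ≢ 2) where

    [-x]^p≡-x^p : ∀ x → (- x) ^ p ≡ - x ^ p
    [-x]^p≡-x^p x = subst (λ e → (- x) ^ e ≡ - x ^ e) (sym (prime≢2⇒odd p-prime p≢2)) ([-x]^odd≡-x^odd x (p ℕ./ 2))

    Φ[t,1-t]≡-Φ[-t,1] : ∀ t → Φ t (1ℤ - t) ≡ - Φ (- t) 1ℤ
    Φ[t,1-t]≡-Φ[-t,1] t = ℤₚ.*-cancelˡ-≡ (+ p) _ _ (begin
      + p * Φ t (1ℤ - t)                          ≡⟨ p*Φ≡[x+y]^p-x^p-y^p t (1ℤ - t) ⟩
      (t + (1ℤ - t)) ^ p - t ^ p - (1ℤ - t) ^ p   ≡⟨ cong (λ s → s ^ p - t ^ p - (1ℤ - t) ^ p) (t+[1-t]≡1 t) ⟩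
      1ℤ ^ p - t ^ p - (1ℤ - t) ^ p               ≡⟨ regroup (1ℤ ^ p) (t ^ p) ((1ℤ - t) ^ p) ⟩
      - ((1ℤ - t) ^ p - - t ^ p - 1ℤ ^ p)         ≡⟨ cong₂ (λ s u → - (s ^ p - u - 1ℤ ^ p)) (1-t≡-t+1 t) (sym ([-x]^p≡-x^p t)) ⟩
      - ((- t + 1ℤ) ^ p - (- t) ^ p - 1ℤ ^ p)     ≡⟨ cong -_ (p*Φ≡[x+y]^p-x^p-y^p (- t) 1ℤ) ⟨
      - (+ p * Φ (- t) 1ℤ)                        ≡⟨ ℤₚ.neg-distribʳ-* (+ p) (Φ (- t) 1ℤ) ⟩
      + p * - Φ (- t) 1ℤ                          ∎)
      where
      open ≡-Reasoning
      t+[1-t]≡1 : ∀ t → t + (1ℤ - t) ≡ 1ℤ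
      t+[1-t]≡1 = solve-∀
      1-t≡-t+1 : ∀ t → 1ℤ - t ≡ - t + 1ℤ
      1-t≡-t+1 = solve-∀
      regroup : ∀ o a b → o - a - b ≡ - (b - - a - o)
      regroup = solve-∀

    mirimanoff≈Φ[t,1-t] : ∀ t → + mirimanoff p t ≈ Φ (+ t) (1ℤ - + t)
    mirimanoff≈Φ[t,1-t] t = ≈-trans (mirimanoff≈-Φ[-t,1] t) (≈-reflexive (sym (Φ[t,1-t]≡-Φ[-t,1] (+ t))))

    *-mirimanoff≈Φ : ∀ {n t c x} → + n ≈ c → + t ≈ x → + n * + mirimanoff p t ≈ Φ (c * x) (c * (1ℤ - x))
    *-mirimanoff≈Φ {n} {t} {c} {x} n≈c t≈x = begin
      + n * + mirimanoff p t    ≈⟨ *-cong n≈c (mirimanoff≈Φ[t,1-t] t) ⟩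
      c * Φ (+ t) (1ℤ - + t)    ≈⟨ *-cong (≈-refl {c}) (Φ-cong t≈x (+-cong (≈-refl {1ℤ}) (-‿cong t≈x))) ⟩
      c * Φ x (1ℤ - x)          ≈⟨ *-Φ≈Φ-* c x (1ℤ - x) ⟩
      Φ (c * x) (c * (1ℤ - x))  ∎
      where open ≈-Reasoning ≈-setoid

    mirimanoff-combination≈Φ : ∀ {c} e x → ¬ (c ≈ 0ℤ) →
      + (red c p ℕ.* mirimanoff p (divp p (red e p) (red c p)) ℕ.+ red e p ℕ.* mirimanoff p (red x p))
        ≈ Φ e (c - e) + Φ (e * x) (e * (1ℤ - x))
    mirimanoff-combination≈Φ {c} e x c≉0 = begin
      + (red c p ℕ.* γ[e/c] ℕ.+ red e p ℕ.* γ[x])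
        ≡⟨ ℤₚ.pos-+ (red c p ℕ.* γ[e/c]) (red e p ℕ.* γ[x]) ⟩
      + (red c p ℕ.* γ[e/c]) + + (red e p ℕ.* γ[x])
        ≡⟨ cong₂ _+_ (ℤₚ.pos-* (red c p) γ[e/c]) (ℤₚ.pos-* (red e p) γ[x]) ⟩
      + red c p * + γ[e/c] + + red e p * + γ[x]
        ≈⟨ +-cong (*-mirimanoff≈Φ (red≈ c) e/c≈e*ι) (*-mirimanoff≈Φ (red≈ e) (red≈ x)) ⟩
      Φ (c * (e * ι)) (c * (1ℤ - e * ι)) + Φ (e * x) (e * (1ℤ - x))
        ≈⟨ +-cong (Φ-cong c[eι]≈e c[1-eι]≈c-e) (≈-refl {Φ (e * x) (e * (1ℤ - x))}) ⟩
      Φ e (c - e) + Φ (e * x) (e * (1ℤ - x))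
        ∎
      where
      open ≈-Reasoning ≈-setoid
      ι : ℤ
      ι = + inv p (red c p)
      γ[e/c] γ[x] : ℕ
      γ[e/c] = mirimanoff p (divp p (red e p) (red c p))
      γ[x] = mirimanoff p (red x p)
      cι≈1 : c * ι ≈ 1ℤ
      cι≈1 = ≈-trans (*-cong (≈-sym (red≈ c)) (≈-refl {ι}))
                     (*-inv≈1 p-prime (λ c̄≈0 → c≉0 (≈-trans (≈-sym (red≈ c)) c̄≈0)))
      e/c≈e*ι : + divp p (red e p) (red c p) ≈ e * ι
      e/c≈e*ι = ≈-trans (red≈ (+ (red e p ℕ.* inv p (red c p))))
                        (≈-trans (≈-reflexive (ℤₚ.pos-* (red e p) (inv p (red c p)))) (*-cong (red≈ e) (≈-refl {ι})))
      e[cι]≈e : e * (c * ι) ≈ e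
      e[cι]≈e = ≈-trans (*-cong (≈-refl {e}) cι≈1) (≈-reflexive (ℤₚ.*-identityʳ e))
      c[eι]≈e : c * (e * ι) ≈ e
      c[eι]≈e = ≈-trans (≈-reflexive (x∙yz≈y∙xz c e ι)) e[cι]≈e
      distribute : ∀ c e ι → c * (1ℤ - e * ι) ≡ c - e * (c * ι)
      distribute = solve-∀
      c[1-eι]≈c-e : c * (1ℤ - e * ι) ≈ c - e
      c[1-eι]≈c-e = ≈-trans (≈-reflexive (distribute c e ι)) (+-cong (≈-refl {c}) (-‿cong e[cι]≈e))

proposition1 : (p : ℕ) → .{{_ : NonZero p}} → Prime p → p ≢ 2 → (a b : ℤ) →
    red a p ≢ 0 → red a p ≢ 1 → red b p ≢ 0 → red b p ≢ 1 →
    red (a * b) p ≢ 0 → red (a * b) p ≢ 1 →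
    (red (+ 1 - a * b) p *ℕ mirimanoff p (divp p (red (+ 1 - b) p) (red (+ 1 - a * b) p))
      +ℕ red (+ 1 - b) p *ℕ mirimanoff p (red a p)) %ℕ p
    ≡ (red (+ 1 - a * b) p *ℕ mirimanoff p (divp p (red (+ 1 - a) p) (red (+ 1 - a * b) p))
      +ℕ red (+ 1 - a) p *ℕ mirimanoff p (red b p)) %ℕ p
proposition1 zero    p-prime = contradiction p-prime ¬prime[0]
proposition1 (suc m) p-prime p≢2 a b _ _ _ _ _ red[ab]≢1 = ≈⇒red≡ (begin
  _                                                                   ≈⟨ mirimanoff-combination≈Φ p≢2 (1ℤ - b) a c≉0 ⟩
  Φ (1ℤ - b) (c - (1ℤ - b)) + Φ ((1ℤ - b) * a) ((1ℤ - b) * (1ℤ - a))  ≡⟨ Φ-four-term a b ⟩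
  Φ (1ℤ - a) (c - (1ℤ - a)) + Φ ((1ℤ - a) * b) ((1ℤ - a) * (1ℤ - b))  ≈⟨ mirimanoff-combination≈Φ p≢2 (1ℤ - a) b c≉0 ⟨
  _                                                                   ∎)
  where
  open FermatQuotient m p-prime
  open ≈-Reasoning ≈-setoid
  c : ℤ
  c = 1ℤ - a * b
  c≉0 : ¬ (c ≈ 0ℤ)
  c≉0 = red≢1⇒1-x≉0 {a * b} red[ab]≢1
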